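{- Let $n\ge1$ and let $P=K_{n,n}$ be the poset with $n$ minimal elements $a_1,\dots,a_n$ and $n$ maximal elements $b_1,\dots,b_n$, with $a_i<b_j$ for all $i,j$. Then $U_P$ is Gorenstein.
   Context: Identify $P$ with $[2n]$; $U_P$ is the affine toric variety of the braid cone $\sigma_P=\{x\in\mathbb{R}^{2n}/\mathbb{R}(1,\dots,1): x_i\le x_j\text{ whenever } i<_Pj\}$ over the lattice $\mathbb{Z}^{2n}/\mathbb{Z}(1,\dots,1)$. $U_P$ is Gorenstein if some vector $u$ of the dual lattice satisfies $\langle u,v\rangle=1$ for every ray generator $v$ of $\sigma_P$. -}

module Defs where

open import Data.Nat as ℕ using (ℕ; zero; suc)
open import Data.Fin using (Fin; toℕ; zero; suc)
open import Data.Integer using (ℤ; +_; -[1+_]; _+_; _*_; _≤_; 0ℤ; 1ℤ; -1ℤ)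
open import Data.Product using (Σ; ∃; _×_; _,_)
open import Data.Sum using (_⊎_)
open import Relation.Binary.PropositionalEquality using (_≡_)
open import Relation.Nullary using (¬_)

Vecℤ : ℕ → Set
Vecℤ m = Fin m → ℤ

sumℤ : ∀ {m} → Vecℤ m → ℤ
sumℤ {zero}  v = 0ℤ
sumℤ {suc m} v = v zero + sumℤ (λ i → v (suc i))

⟪_,_⟫ : ∀ {m} → Vecℤ m → Vecℤ m → ℤ
⟪ u , v ⟫ = sumℤ (λ i → u i * v i)

_⊕_ : ∀ {m} → Vecℤ m → Vecℤ m → Vecℤ m
(v ⊕ w) i = v i + w i

_·_ : ∀ {m} → ℤ → Vecℤ m → Vecℤ m
(k · v) i = k * v i

-- Equality in the quotient lattice ℤ^m / ℤ(1,…,1).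
_≡ₘ_ : ∀ {m} → Vecℤ m → Vecℤ m → Set
_≡ₘ_ {m} v w = ∃ λ (c : ℤ) → ∀ (i : Fin m) → v i ≡ w i + c

IsZeroₘ : ∀ {m} → Vecℤ m → Set
IsZeroₘ v = v ≡ₘ (λ _ → 0ℤ)

-- A poset on [m] = Fin m given by its strict order relation.
-- Lattice points of the braid cone σ_P: x_i ≤ x_j whenever i <_P j
-- (well defined on classes modulo ℤ(1,…,1)).
InCone : ∀ {m} → (Fin m → Fin m → Set) → Vecℤ m → Set
InCone {m} lt x = ∀ (i j : Fin m) → lt i j → x i ≤ x j

-- v spans an extremal ray of σ_P: whenever a positive multiple of v
-- splits as a sum of two lattice points of σ_P, each summand lies on
-- the ray ℝ≥0·v (i.e. some positive multiple of it is a nonnegative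
-- multiple of v), all modulo ℤ(1,…,1).
Extremal : ∀ {m} → (Fin m → Fin m → Set) → Vecℤ m → Set
Extremal lt v =
  ∀ (k : ℕ) w₁ w₂ → InCone lt w₁ → InCone lt w₂ →
    ((+ suc k) · v) ≡ₘ (w₁ ⊕ w₂) →
    (∃ λ (q : ℕ) → ∃ λ (p : ℕ) → ((+ suc q) · w₁) ≡ₘ ((+ p) · v))
    × (∃ λ (q : ℕ) → ∃ λ (p : ℕ) → ((+ suc q) · w₂) ≡ₘ ((+ p) · v))

Primitive : ∀ {m} → Vecℤ m → Set
Primitive {m} v = ∀ (k : ℤ) (w : Vecℤ m) → v ≡ₘ (k · w) → (k ≡ 1ℤ) ⊎ (k ≡ -1ℤ)

RayGenerator : ∀ {m} → (Fin m → Fin m → Set) → Vecℤ m → Set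
RayGenerator lt v = InCone lt v × ¬ IsZeroₘ v × Primitive v × Extremal lt v

-- U_P is Gorenstein: some u in the dual lattice
-- (ℤ^m/ℤ(1,…,1))^* = {u ∈ ℤ^m : Σ u_i = 0} pairs to 1 with every ray generator.
Gorenstein : ∀ {m} → (Fin m → Fin m → Set) → Set
Gorenstein {m} lt =
  ∃ λ (u : Vecℤ m) → (sumℤ u ≡ 0ℤ) × (∀ v → RayGenerator lt v → ⟪ u , v ⟫ ≡ 1ℤ)

-- The poset K_{n,n} on [2n] = Fin (n + n): elements with index < n are
-- a_1..a_n (minimal), elements with index ≥ n are b_1..b_n (maximal),
-- and a_i < b_j for all i, j (no other strict relations).
Knn : (n : ℕ) → Fin (n ℕ.+ n) → Fin (n ℕ.+ n) → Set
Knn n i j = (toℕ i ℕ.< n) × (n ℕ.≤ toℕ j)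

{-# OPTIONS --safe #-}
-- Take u = -1 on the minimal elements a_i and +1 on the maximal elements b_j,
-- so Σ u = 0.  Let v be a ray generator.  If some v_b exceeds every v_a, then
-- e_b and v - e_b both lie in σ_P; extremality puts e_b on the ray of v, so v
-- is constant away from b, and primitivity (with positivity of the ray) gives
-- v ≡ e_b modulo constants, whence ⟨u, v⟩ = u_b = 1.  Dually, if some v_a lies
-- below every v_b, then v ≡ -e_a and ⟨u, v⟩ = -u_a = 1.  Otherwise the cone
-- inequalities v_a ≤ v_b squeeze v to a constant, i.e. v = 0 in the quotient.
module Submission where

open import Defs
open import Data.Nat as ℕ using (ℕ; zero; suc; _≤_; _<_)
import Data.Nat.Properties as ℕ
open import Data.Fin using (Fin; zero; suc; toℕ; _↑ˡ_; _↑ʳ_)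
open import Data.Fin.Properties using (_≟_; any?; all?; ¬∀⟶∃¬; toℕ-↑ˡ; toℕ-↑ʳ; toℕ<n)
open import Data.Integer as ℤ using (ℤ; +_; _+_; _*_; _-_; -_; 0ℤ; 1ℤ; -1ℤ)
import Data.Integer.Properties as ℤ
open import Data.Integer.Tactic.RingSolver using (solve-∀)
open import Algebra.Properties.Semiring.Sum ℤ.+-*-semiring
  using (sum; sum-cong-≗; sum-replicate-zero; ∑-distrib-+; *-distribˡ-sum; *-distribʳ-sum)
open import Algebra.Properties.AbelianGroup ℤ.+-0-abelianGroup using (∙-cancelʳ)
open import Data.Product using (∃; _×_; _,_; proj₁; proj₂)
open import Data.Sum using (_⊎_; inj₁; inj₂)
open import Data.Empty using (⊥-elim)
open import Data.Bool using (if_then_else_)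
open import Function using (_∘_; flip)
open import Relation.Nullary using (¬_; yes; no; does)
open import Relation.Nullary.Decidable using (_×-dec_; _→-dec_; dec-true; dec-false)
open import Relation.Unary using (Pred; Decidable)
open import Relation.Binary.PropositionalEquality

private
  variable
    m : ℕ
    lt : Fin m → Fin m → Set
    u v w : Vecℤ m
    i j i₀ : Fin m
    σ : ℤ

sumℤ≡sum : (v : Vecℤ m) → sumℤ v ≡ sum v
sumℤ≡sum {zero}  v = refl
sumℤ≡sum {suc m} v = cong (_+_ (v zero)) (sumℤ≡sum (v ∘ suc))

sumℤ-cong : (∀ i → v i ≡ w i) → sumℤ v ≡ sumℤ w
sumℤ-cong {v = v} {w} v≗w = trans (sumℤ≡sum v) (trans (sum-cong-≗ v≗w) (sym (sumℤ≡sum w)))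

sumℤ-zero : (∀ i → v i ≡ 0ℤ) → sumℤ v ≡ 0ℤ
sumℤ-zero {m} v≗0 =
  trans (sumℤ-cong {w = λ _ → 0ℤ} v≗0) (trans (sumℤ≡sum {m} (λ _ → 0ℤ)) (sum-replicate-zero m))

sumℤ-+ : (v w : Vecℤ m) → sumℤ (v ⊕ w) ≡ sumℤ v + sumℤ w
sumℤ-+ v w = begin
  sumℤ (v ⊕ w)      ≡⟨ sumℤ≡sum (v ⊕ w) ⟩
  sum (v ⊕ w)       ≡⟨ ∑-distrib-+ v w ⟩
  sum v + sum w     ≡⟨ sym (cong₂ _+_ (sumℤ≡sum v) (sumℤ≡sum w)) ⟩
  sumℤ v + sumℤ w   ∎
  where open ≡-Reasoning

sumℤ-*ʳ : (c : ℤ) (v : Vecℤ m) → sumℤ (λ i → v i * c) ≡ sumℤ v * c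
sumℤ-*ʳ c v =
  trans (sumℤ≡sum (λ i → v i * c)) (sym (trans (cong (_* c) (sumℤ≡sum v)) (*-distribʳ-sum c v)))

sumℤ-↑ : ∀ m k (v : Vecℤ (m ℕ.+ k)) →
         sumℤ v ≡ sumℤ (λ i → v (i ↑ˡ k)) + sumℤ (λ i → v (m ↑ʳ i))
sumℤ-↑ zero    k v = sym (ℤ.+-identityˡ _)
sumℤ-↑ (suc m) k v = trans (cong (_+_ (v zero)) (sumℤ-↑ m k (v ∘ suc))) (sym (ℤ.+-assoc (v zero) _ _))

⟪⟫-resp-≡ₘ : sumℤ u ≡ 0ℤ → v ≡ₘ w → ⟪ u , v ⟫ ≡ ⟪ u , w ⟫
⟪⟫-resp-≡ₘ {u = u} {v} {w} Σu≡0 (c , v≡w+c) = begin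
  ⟪ u , v ⟫                                  ≡⟨ sumℤ-cong (λ i → cong (u i *_) (v≡w+c i)) ⟩
  sumℤ (λ i → u i * (w i + c))               ≡⟨ sumℤ-cong (λ i → ℤ.*-distribˡ-+ (u i) (w i) c) ⟩
  sumℤ (λ i → u i * w i + u i * c)           ≡⟨ sumℤ-+ (λ i → u i * w i) (λ i → u i * c) ⟩
  ⟪ u , w ⟫ + sumℤ (λ i → u i * c)           ≡⟨ cong (_+_ ⟪ u , w ⟫) (sumℤ-*ʳ c u) ⟩
  ⟪ u , w ⟫ + sumℤ u * c                     ≡⟨ cong (λ s → ⟪ u , w ⟫ + s * c) Σu≡0 ⟩
  ⟪ u , w ⟫ + 0ℤ * c                         ≡⟨ cong (_+_ ⟪ u , w ⟫) (ℤ.*-zeroˡ c) ⟩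
  ⟪ u , w ⟫ + 0ℤ                             ≡⟨ ℤ.+-identityʳ _ ⟩
  ⟪ u , w ⟫                                  ∎
  where open ≡-Reasoning

basis : Fin m → Vecℤ m
basis zero    zero    = 1ℤ
basis zero    (suc _) = 0ℤ
basis (suc j) zero    = 0ℤ
basis (suc j) (suc i) = basis j i

basis-diag : (j : Fin m) → basis j j ≡ 1ℤ
basis-diag zero    = refl
basis-diag (suc j) = basis-diag j

basis-off : i ≢ j → basis j i ≡ 0ℤ
basis-off {i = zero}  {zero}  i≢j = ⊥-elim (i≢j refl)
basis-off {i = zero}  {suc j} _   = refl
basis-off {i = suc i} {zero}  _   = refl
basis-off {i = suc i} {suc j} i≢j = basis-off (i≢j ∘ cong suc)

basis-nonneg : (j i : Fin m) → 0ℤ ℤ.≤ basis j i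
basis-nonneg zero    zero    = ℤ.+≤+ ℕ.z≤n
basis-nonneg zero    (suc _) = ℤ.+≤+ ℕ.z≤n
basis-nonneg (suc j) zero    = ℤ.+≤+ ℕ.z≤n
basis-nonneg (suc j) (suc i) = basis-nonneg j i

⟪⟫-basis : (u : Vecℤ m) (j : Fin m) → ⟪ u , basis j ⟫ ≡ u j
⟪⟫-basis u zero =
  trans (cong₂ _+_ (ℤ.*-identityʳ (u zero)) (sumℤ-zero (ℤ.*-zeroʳ ∘ u ∘ suc))) (ℤ.+-identityʳ (u zero))
⟪⟫-basis u (suc j) =
  trans (cong₂ _+_ (ℤ.*-zeroʳ (u zero)) (⟪⟫-basis (u ∘ suc) j)) (ℤ.+-identityˡ (u (suc j)))

⟪⟫-·ʳ : (u : Vecℤ m) (k : ℤ) (w : Vecℤ m) → ⟪ u , k · w ⟫ ≡ k * ⟪ u , w ⟫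
⟪⟫-·ʳ u k w = begin
  sumℤ (λ i → u i * (k * w i)) ≡⟨ sumℤ-cong (λ i → swap (u i) k (w i)) ⟩
  sumℤ (λ i → k * (u i * w i)) ≡⟨ sumℤ≡sum (λ i → k * (u i * w i)) ⟩
  sum (λ i → k * (u i * w i))  ≡⟨ *-distribˡ-sum k (λ i → u i * w i) ⟨
  k * sum (λ i → u i * w i)    ≡⟨ cong (k *_) (sumℤ≡sum (λ i → u i * w i)) ⟨
  k * ⟪ u , w ⟫                ∎
  where
  open ≡-Reasoning
  swap : ∀ x y z → x * (y * z) ≡ y * (x * z)
  swap = solve-∀

IsUnit : ℤ → Set
IsUnit σ = (σ ≡ 1ℤ) ⊎ (σ ≡ -1ℤ)

unit*unit≡1 : IsUnit σ → σ * σ ≡ 1ℤ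
unit*unit≡1 (inj₁ refl) = refl
unit*unit≡1 (inj₂ refl) = refl

suc*unit≢0 : ∀ q → IsUnit σ → + suc q * σ ≢ 0ℤ
suc*unit≢0 q (inj₁ refl) ()
suc*unit≢0 q (inj₂ refl) ()

units-same-sign : ∀ {d} q p → IsUnit σ → IsUnit d → + suc q * σ ≡ + p * d → d ≡ σ
units-same-sign q p       (inj₁ refl) (inj₁ refl) _  = refl
units-same-sign q zero    (inj₁ refl) (inj₂ refl) ()
units-same-sign q (suc p) (inj₁ refl) (inj₂ refl) ()
units-same-sign q zero    (inj₂ refl) (inj₁ refl) ()
units-same-sign q (suc p) (inj₂ refl) (inj₁ refl) ()
units-same-sign q p       (inj₂ refl) (inj₂ refl) _  = refl

_⊖_ : Vecℤ m → Vecℤ m → Vecℤ m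
(v ⊖ w) i = v i - w i

Maximal : (Fin m → Fin m → Set) → Fin m → Set
Maximal lt j = ∀ k → ¬ lt j k

Minimal : (Fin m → Fin m → Set) → Fin m → Set
Minimal lt j = ∀ i → ¬ lt i j

SplitsOff : (Fin m → Fin m → Set) → Vecℤ m → Vecℤ m → Set
SplitsOff lt v w = InCone lt w × InCone lt (v ⊖ w)

InCone-resp : (∀ i → v i ≡ w i) → InCone lt v → InCone lt w
InCone-resp v≗w v∈σ i k i<k = subst₂ ℤ._≤_ (v≗w i) (v≗w k) (v∈σ i k i<k)

InCone-neg : InCone lt v → InCone (flip lt) (λ i → - v i)
InCone-neg v∈σ i k k<i = ℤ.neg-mono-≤ (v∈σ k i k<i)

splitsOff-maximal : Maximal lt j → (∀ i → lt i j → v i ℤ.< v j) → InCone lt v →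
                    SplitsOff lt v (1ℤ · basis j)
splitsOff-maximal {lt = lt} {j = j} {v = v} max below v∈σ =
  InCone-resp (λ i → sym (ℤ.*-identityˡ (basis j i))) basis∈σ ,
  InCone-resp (λ i → cong (_-_ (v i)) (sym (ℤ.*-identityˡ (basis j i)))) rest∈σ
  where
  source-off : ∀ {i k} → lt i k → basis j i ≡ 0ℤ
  source-off {i} {k} i<k = basis-off {i = i} {j} λ { refl → max k i<k }

  basis∈σ : InCone lt (basis j)
  basis∈σ i k i<k = subst (ℤ._≤ basis j k) (sym (source-off i<k)) (basis-nonneg j k)

  rest∈σ : InCone lt (v ⊖ basis j)
  rest∈σ i k i<k rewrite source-off i<k | ℤ.+-identityʳ (v i) with k ≟ j
  ... | yes refl rewrite basis-diag j =
    subst (v i ℤ.≤_) (ℤ.+-comm -1ℤ (v j)) (ℤ.i<j⇒i≤pred[j] (below i i<k))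
  ... | no k≢j rewrite basis-off k≢j | ℤ.+-identityʳ (v k) = v∈σ i k i<k

splitsOff-minimal : Minimal lt j → (∀ k → lt j k → v j ℤ.< v k) → InCone lt v →
                    SplitsOff lt v (-1ℤ · basis j)
splitsOff-minimal {lt = lt} {j = j} {v = v} min above v∈σ =
  InCone-resp (λ i → negate-basis (basis j i)) (InCone-neg (proj₁ splitᵒᵖ)) ,
  InCone-resp (λ i → negate-rest (v i) (basis j i)) (InCone-neg (proj₂ splitᵒᵖ))
  where
  negate-basis : ∀ x → - (1ℤ * x) ≡ -1ℤ * x
  negate-basis = solve-∀
  negate-rest : ∀ x y → - (- x - 1ℤ * y) ≡ x - -1ℤ * y
  negate-rest = solve-∀

  splitᵒᵖ : SplitsOff (flip lt) (λ i → - v i) (1ℤ · basis j)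
  splitᵒᵖ = splitsOff-maximal min (λ k j<k → ℤ.neg-mono-< (above k j<k)) (InCone-neg v∈σ)

⊕⊖-≡ₘ : (v w : Vecℤ m) → ((+ 1) · v) ≡ₘ (w ⊕ (v ⊖ w))
⊕⊖-≡ₘ v w = 0ℤ , λ i → regroup (v i) (w i)
  where
  regroup : ∀ x y → + 1 * x ≡ (y + (x - y)) + 0ℤ
  regroup = solve-∀

constant-off⇒≡ₘ-basis : (∀ i → i ≢ j → v i ≡ v i₀) → v ≡ₘ ((v j - v i₀) · basis j)
constant-off⇒≡ₘ-basis {j = j} {v = v} {i₀ = i₀} flat = v i₀ , pointwise
  where
  recombine : ∀ x y → x ≡ (x - y) * 1ℤ + y
  recombine = solve-∀
  absorb : ∀ x y → y ≡ x * 0ℤ + y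
  absorb = solve-∀

  pointwise : ∀ i → v i ≡ (v j - v i₀) * basis j i + v i₀
  pointwise i with i ≟ j
  ... | yes refl rewrite basis-diag i = recombine (v i) (v i₀)
  ... | no i≢j rewrite basis-off i≢j = trans (flat i i≢j) (absorb (v j - v i₀) (v i₀))

scaled-basis≡ₘ⇒ : ∀ a b → i₀ ≢ j → (a · (σ · basis j)) ≡ₘ (b · v) →
                  a * σ ≡ b * (v j - v i₀) × (∀ i → i ≢ j → b * v i ≡ b * v i₀)
scaled-basis≡ₘ⇒ {i₀ = i₀} {j = j} {σ = σ} {v = v} a b i₀≢j (c , ≡b·v+c) = at-j , flat
  where
  vanishes-off-j : ∀ i → i ≢ j → b * v i + c ≡ 0ℤ
  vanishes-off-j i i≢j = begin
    b * v i + c           ≡⟨ ≡b·v+c i ⟨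
    a * (σ * basis j i)   ≡⟨ cong (λ x → a * (σ * x)) (basis-off i≢j) ⟩
    a * (σ * 0ℤ)          ≡⟨ cong (a *_) (ℤ.*-zeroʳ σ) ⟩
    a * 0ℤ                ≡⟨ ℤ.*-zeroʳ a ⟩
    0ℤ                    ∎
    where open ≡-Reasoning

  flat : ∀ i → i ≢ j → b * v i ≡ b * v i₀
  flat i i≢j =
    ∙-cancelʳ c (b * v i) (b * v i₀) (trans (vanishes-off-j i i≢j) (sym (vanishes-off-j i₀ i₀≢j)))

  regroup : ∀ b c x y → b * x + c ≡ b * (x - y) + (b * y + c)
  regroup = solve-∀

  at-j : a * σ ≡ b * (v j - v i₀)
  at-j = begin
    a * σ                            ≡⟨ cong (λ x → a * x) (ℤ.*-identityʳ σ) ⟨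
    a * (σ * 1ℤ)                     ≡⟨ cong (λ x → a * (σ * x)) (basis-diag j) ⟨
    a * (σ * basis j j)              ≡⟨ ≡b·v+c j ⟩
    b * v j + c                      ≡⟨ regroup b c (v j) (v i₀) ⟩
    b * (v j - v i₀) + (b * v i₀ + c) ≡⟨ cong (_+_ (b * (v j - v i₀))) (vanishes-off-j i₀ i₀≢j) ⟩
    b * (v j - v i₀) + 0ℤ            ≡⟨ ℤ.+-identityʳ _ ⟩
    b * (v j - v i₀)                 ∎
    where open ≡-Reasoning

splitsOff-unit⇒≡ₘ : Primitive v → Extremal lt v → IsUnit σ → i₀ ≢ j →
                    SplitsOff lt v (σ · basis j) → v ≡ₘ (σ · basis j)
splitsOff-unit⇒≡ₘ {v = v} {σ = σ} {i₀ = i₀} {j = j} prim ext σ±1 i₀≢j (w∈σ , rest∈σ) =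
  on-ray (proj₁ (ext 0 (σ · basis j) (v ⊖ (σ · basis j)) w∈σ rest∈σ (⊕⊖-≡ₘ v (σ · basis j))))
  where
  readout : ∀ q p → ((+ suc q) · (σ · basis j)) ≡ₘ ((+ p) · v) →
            + suc q * σ ≡ + p * (v j - v i₀) × (∀ i → i ≢ j → + p * v i ≡ + p * v i₀)
  readout q p = scaled-basis≡ₘ⇒ {σ = σ} {v = v} (+ suc q) (+ p) i₀≢j

  on-ray : (∃ λ q → ∃ λ p → ((+ suc q) · (σ · basis j)) ≡ₘ ((+ p) · v)) → v ≡ₘ (σ · basis j)
  on-ray (q , zero , eq) =
    ⊥-elim (suc*unit≢0 q σ±1 (trans (proj₁ (readout q 0 eq)) (ℤ.*-zeroˡ (v j - v i₀))))
  on-ray (q , suc p , eq) =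
    subst (λ d → v ≡ₘ (d · basis j)) (units-same-sign q (suc p) σ±1 d±1 at-j) v≡ₘd·e
    where
    at-j : + suc q * σ ≡ + suc p * (v j - v i₀)
    at-j = proj₁ (readout q (suc p) eq)
    v≡ₘd·e : v ≡ₘ ((v j - v i₀) · basis j)
    v≡ₘd·e = constant-off⇒≡ₘ-basis λ i i≢j →
      ℤ.*-cancelˡ-≡ (+ suc p) (v i) (v i₀) (proj₂ (readout q (suc p) eq) i i≢j)
    d±1 : IsUnit (v j - v i₀)
    d±1 = prim (v j - v i₀) (basis j) v≡ₘd·e

splitsOff-unit⇒⟪⟫≡1 : sumℤ u ≡ 0ℤ → Primitive v → Extremal lt v →
                      IsUnit σ → u j ≡ σ → i₀ ≢ j →
                      SplitsOff lt v (σ · basis j) → ⟪ u , v ⟫ ≡ 1ℤ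
splitsOff-unit⇒⟪⟫≡1 {u = u} {v = v} {σ = σ} {j = j} Σu≡0 prim ext σ±1 uj≡σ i₀≢j split =
  begin
  ⟪ u , v ⟫             ≡⟨ ⟪⟫-resp-≡ₘ Σu≡0 (splitsOff-unit⇒≡ₘ prim ext σ±1 i₀≢j split) ⟩
  ⟪ u , σ · basis j ⟫   ≡⟨ ⟪⟫-·ʳ u σ (basis j) ⟩
  σ * ⟪ u , basis j ⟫   ≡⟨ cong (σ *_) (trans (⟪⟫-basis u j) uj≡σ) ⟩
  σ * σ                 ≡⟨ unit*unit≡1 σ±1 ⟩
  1ℤ                    ∎
  where open ≡-Reasoning

∃-counterexample : ∀ {p q} {P : Pred (Fin m) p} {Q : Pred (Fin m) q} → Decidable P → Decidable Q →
                   ¬ (∀ i → P i → Q i) → ∃ λ i → P i × ¬ Q i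
∃-counterexample P? Q? ¬∀ with ¬∀⟶∃¬ _ _ (λ i → P? i →-dec Q? i) ¬∀
... | i , ¬[P→Q] with P? i
...   | yes p = i , p , λ q → ¬[P→Q] (λ _ → q)
...   | no ¬p = ⊥-elim (¬[P→Q] (⊥-elim ∘ ¬p))

knnDual : (N : ℕ) → Vecℤ (N ℕ.+ N)
knnDual N i = if does (toℕ i ℕ.<? N) then -1ℤ else 1ℤ

module _ {N : ℕ} where

  knnDual-lower : {i : Fin (N ℕ.+ N)} → toℕ i < N → knnDual N i ≡ -1ℤ
  knnDual-lower {i} lower rewrite dec-true (toℕ i ℕ.<? N) lower = refl

  knnDual-upper : {i : Fin (N ℕ.+ N)} → N ≤ toℕ i → knnDual N i ≡ 1ℤ
  knnDual-upper {i} upper rewrite dec-false (toℕ i ℕ.<? N) (ℕ.≤⇒≯ upper) = refl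

  ↑ˡ-lower : (i : Fin N) → toℕ (i ↑ˡ N) < N
  ↑ˡ-lower i = subst (_< N) (sym (toℕ-↑ˡ i N)) (toℕ<n i)

  ↑ʳ-upper : (i : Fin N) → N ≤ toℕ (N ↑ʳ i)
  ↑ʳ-upper i = subst (N ≤_) (sym (toℕ-↑ʳ N i)) (ℕ.m≤m+n N (toℕ i))

  lower≢upper : {i j : Fin (N ℕ.+ N)} → toℕ i < N → N ≤ toℕ j → i ≢ j
  lower≢upper lower upper refl = ℕ.<⇒≱ lower upper

  Knn-upper-maximal : {j : Fin (N ℕ.+ N)} → N ≤ toℕ j → Maximal (Knn N) j
  Knn-upper-maximal upper _ (lower , _) = ℕ.<⇒≱ lower upper

  Knn-lower-minimal : {i : Fin (N ℕ.+ N)} → toℕ i < N → Minimal (Knn N) i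
  Knn-lower-minimal lower _ (_ , upper) = ℕ.<⇒≱ lower upper

knnDual-sum : ∀ N → sumℤ (knnDual N) ≡ 0ℤ
knnDual-sum N = begin
  sumℤ (knnDual N)
    ≡⟨ sumℤ-↑ N N (knnDual N) ⟩
  sumℤ (λ i → knnDual N (i ↑ˡ N)) + sumℤ (λ i → knnDual N (N ↑ʳ i))
    ≡⟨ sumℤ-+ (λ i → knnDual N (i ↑ˡ N)) (λ i → knnDual N (N ↑ʳ i)) ⟨
  sumℤ (λ i → knnDual N (i ↑ˡ N) + knnDual N (N ↑ʳ i))
    ≡⟨ sumℤ-zero (λ i → cong₂ _+_ (knnDual-lower (↑ˡ-lower i)) (knnDual-upper (↑ʳ-upper {N} i))) ⟩
  0ℤ ∎
  where open ≡-Reasoning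

module _ {n : ℕ} {v : Vecℤ (suc n ℕ.+ suc n)} (v∈σ : InCone (Knn (suc n)) v) where
  private
    N = suc n

  AboveAllLower : Fin (N ℕ.+ N) → Set
  AboveAllLower b = N ≤ toℕ b × (∀ a → toℕ a < N → v a ℤ.< v b)

  BelowAllUpper : Fin (N ℕ.+ N) → Set
  BelowAllUpper a = toℕ a < N × (∀ b → N ≤ toℕ b → v a ℤ.< v b)

  aboveAllLower? : Decidable AboveAllLower
  aboveAllLower? b = (N ℕ.≤? toℕ b) ×-dec all? (λ a → (toℕ a ℕ.<? N) →-dec (v a ℤ.<? v b))

  belowAllUpper? : Decidable BelowAllUpper
  belowAllUpper? a = (toℕ a ℕ.<? N) ×-dec all? (λ b → (N ℕ.≤? toℕ b) →-dec (v a ℤ.<? v b))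

  Knn-cone-constant : (∀ b → N ≤ toℕ b → ∃ λ a → toℕ a < N × v b ℤ.≤ v a) →
                      (∀ a → toℕ a < N → ∃ λ b → N ≤ toℕ b × v b ℤ.≤ v a) →
                      IsZeroₘ v
  Knn-cone-constant under over = v zero , λ i → trans (≡v₀ i) (sym (ℤ.+-identityˡ (v zero)))
    where
    lower-≡v₀ : ∀ a → toℕ a < N → v a ≡ v zero
    lower-≡v₀ a lower with over a lower | over zero ℕ.z<s
    ... | b , upper , vb≤va | b₀ , upper₀ , vb₀≤v₀ = ℤ.≤-antisym
      (ℤ.≤-trans (v∈σ a b₀ (lower , upper₀)) vb₀≤v₀)
      (ℤ.≤-trans (v∈σ zero b (ℕ.z<s , upper)) vb≤va)

    upper-≡v₀ : ∀ b → N ≤ toℕ b → v b ≡ v zero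
    upper-≡v₀ b upper with under b upper
    ... | a , lower , vb≤va = ℤ.≤-antisym
      (subst (v b ℤ.≤_) (lower-≡v₀ a lower) vb≤va)
      (v∈σ zero b (ℕ.z<s , upper))

    ≡v₀ : ∀ i → v i ≡ v zero
    ≡v₀ i with toℕ i ℕ.<? N
    ... | yes lower = lower-≡v₀ i lower
    ... | no ¬lower = upper-≡v₀ i (ℕ.≮⇒≥ ¬lower)

  Knn-cone-trichotomy : ∃ AboveAllLower ⊎ ∃ BelowAllUpper ⊎ IsZeroₘ v
  Knn-cone-trichotomy with any? aboveAllLower? | any? belowAllUpper?
  ... | yes above | _         = inj₁ above
  ... | no _      | yes below = inj₂ (inj₁ below)
  ... | no ¬above | no ¬below = inj₂ (inj₂ (Knn-cone-constant under over))
    where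
    under : ∀ b → N ≤ toℕ b → ∃ λ a → toℕ a < N × v b ℤ.≤ v a
    under b upper with ∃-counterexample (λ a → toℕ a ℕ.<? N) (λ a → v a ℤ.<? v b)
                                        (λ va<vb → ¬above (b , upper , va<vb))
    ... | a , lower , va≮vb = a , lower , ℤ.≮⇒≥ va≮vb

    over : ∀ a → toℕ a < N → ∃ λ b → N ≤ toℕ b × v b ℤ.≤ v a
    over a lower with ∃-counterexample (λ b → N ℕ.≤? toℕ b) (λ b → v a ℤ.<? v b)
                                       (λ va<vb → ¬below (a , lower , va<vb))
    ... | b , upper , va≮vb = b , upper , ℤ.≮⇒≥ va≮vb

proposition6p5 : (n : ℕ) → 1 ≤ n → Gorenstein (Knn n)
proposition6p5 (suc n) _ = knnDual N , knnDual-sum N , pairs-to-1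
  where
  N = suc n

  pairs-to-1 : ∀ v → RayGenerator (Knn N) v → ⟪ knnDual N , v ⟫ ≡ 1ℤ
  pairs-to-1 v (v∈σ , v≢0 , prim , ext) with Knn-cone-trichotomy v∈σ
  ... | inj₁ (b , upper , above) =
    splitsOff-unit⇒⟪⟫≡1 {u = knnDual N} (knnDual-sum N) prim ext (inj₁ refl) (knnDual-upper upper)
      (lower≢upper ℕ.z<s upper)
      (splitsOff-maximal (Knn-upper-maximal upper) (λ a (lower , _) → above a lower) v∈σ)
  ... | inj₂ (inj₁ (a , lower , below)) =
    splitsOff-unit⇒⟪⟫≡1 {u = knnDual N} (knnDual-sum N) prim ext (inj₂ refl) (knnDual-lower lower)
      (lower≢upper lower (↑ʳ-upper zero) ∘ sym)
      (splitsOff-minimal (Knn-lower-minimal lower) (λ b (_ , upper) → below b upper) v∈σ)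
  ... | inj₂ (inj₂ v≡ₘ0) = ⊥-elim (v≢0 v≡ₘ0)
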